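{- Let $G$ be an $R$-thin graph of order $n\geq 2$. Then $D(\mu(G))\leq D(G)+1$.
   Context: Graphs are finite, simple and undirected. A graph is $R$-thin if no two distinct vertices have the same open neighborhood. For a graph $G$ with vertices $v_1,\dots,v_n$, the Mycielski graph $\mu(G)$ has vertex set $\{v_1,\dots,v_n,u_1,\dots,u_n,w\}$ and edge set consisting of the edges of $G$, the edges $wu_i$ for all $i$, and for every edge $v_iv_j$ of $G$ the two edges $u_iv_j$ and $v_iu_j$. A vertex labeling $\phi:V(H)\to\{1,\dots,r\}$ is $r$-distinguishing if the only automorphism of $H$ preserving all vertex labels is the identity; the distinguishing number $D(H)$ is the least such $r$. -}

module Defs where

open import Data.Nat using (ℕ; _≤_)
open import Data.Fin using (Fin)
open import Data.Bool using (Bool; true; false)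
open import Data.Product using (Σ; _×_)
open import Relation.Binary.PropositionalEquality using (_≡_)

-- A simple undirected graph on vertex type V, given by a Boolean
-- adjacency relation which is symmetric and irreflexive.
-- (Finiteness: we only instantiate V with finite types, Fin n / MV n.)
record Graph (V : Set) : Set where
  field
    adj    : V → V → Bool
    sym    : ∀ x y → adj x y ≡ adj y x
    irrefl : ∀ x → adj x x ≡ false
open Graph public

RThin : {V : Set} → Graph V → Set
RThin {V} G = ∀ (x y : V) → (∀ (z : V) → adj G x z ≡ adj G y z) → x ≡ y

-- Vertices of the Mycielski graph of a graph on Fin n:
-- v i (original), u i (shadow), w (apex).
data MV (n : ℕ) : Set where
  v : Fin n → MV n
  u : Fin n → MV n
  w : MV n

myAdj : {n : ℕ} → Graph (Fin n) → MV n → MV n → Bool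
myAdj G (v i) (v j) = adj G i j
myAdj G (v i) (u j) = adj G i j
myAdj G (u i) (v j) = adj G i j
myAdj G (u i) (u j) = false
myAdj G (u i) w     = true
myAdj G w     (u j) = true
myAdj G (v i) w     = false
myAdj G w     (v j) = false
myAdj G w     w     = false

myAdj-sym : {n : ℕ} (G : Graph (Fin n)) → ∀ x y → myAdj G x y ≡ myAdj G y x
myAdj-sym G (v i) (v j) = sym G i j
myAdj-sym G (v i) (u j) = sym G i j
myAdj-sym G (u i) (v j) = sym G i j
myAdj-sym G (u i) (u j) = _≡_.refl
myAdj-sym G (u i) w     = _≡_.refl
myAdj-sym G w     (u j) = _≡_.refl
myAdj-sym G (v i) w     = _≡_.refl
myAdj-sym G w     (v j) = _≡_.refl
myAdj-sym G w     w     = _≡_.refl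

myAdj-irrefl : {n : ℕ} (G : Graph (Fin n)) → ∀ x → myAdj G x x ≡ false
myAdj-irrefl G (v i) = irrefl G i
myAdj-irrefl G (u i) = _≡_.refl
myAdj-irrefl G w     = _≡_.refl

μ : {n : ℕ} → Graph (Fin n) → Graph (MV n)
μ G = record { adj = myAdj G ; sym = myAdj-sym G ; irrefl = myAdj-irrefl G }

record Automorphism {V : Set} (G : Graph V) : Set where
  field
    fun      : V → V
    inv      : V → V
    inv-fun  : ∀ x → inv (fun x) ≡ x
    fun-inv  : ∀ x → fun (inv x) ≡ x
    preserve : ∀ x y → adj G (fun x) (fun y) ≡ adj G x y
open Automorphism public

Distinguishing : {V : Set} (G : Graph V) (r : ℕ) → (V → Fin r) → Set
Distinguishing {V} G r φ =
  (σ : Automorphism G) → (∀ x → φ (fun σ x) ≡ φ x) → ∀ x → fun σ x ≡ x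

HasDistLabeling : {V : Set} → Graph V → ℕ → Set
HasDistLabeling {V} G r = Σ (V → Fin r) (Distinguishing G r)

IsDistNumber : {V : Set} → Graph V → ℕ → Set
IsDistNumber G d = HasDistLabeling G d × (∀ r → HasDistLabeling G r → d ≤ r)

module Submission where

-- Given a distinguishing labeling φ of G with d labels, label μ(G) by
-- copying φ onto both the original vertex v i and its shadow u i, and
-- give the apex w a fresh (d+1)-st label.  Let σ be an automorphism of
-- μ(G) preserving this labeling.
--   * σ fixes w, since w is the only vertex with the fresh label.
--   * An automorphism fixing w permutes its neighbours, the shadows, and
--     hence also the originals; restricted to the originals it is an
--     automorphism of G (inverse automorphisms give the inverse map).
--   * That restriction preserves φ, so it is the identity.
--   * Once w and all originals are fixed, each shadow u i is sent to a
--     shadow u j whose neighbourhood in G equals that of i; R-thinness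
--     forces j = i.
-- Hence the labeling is (d+1)-distinguishing, and minimality of D(μ(G))
-- gives the theorem.

open import Defs hiding (sym)
open import Data.Nat using (ℕ; _≤_; _+_; suc)
open import Data.Nat.Properties using (+-comm)
open import Data.Fin using (Fin; fromℕ; inject₁)
open import Data.Fin.Properties using (fromℕ≢inject₁; inject₁-injective)
open import Data.Bool using (true; false)
open import Data.Product using (Σ; _,_; proj₁; proj₂)
open import Data.Empty using (⊥-elim)
open import Relation.Binary.PropositionalEquality

module _ {V : Set} {H : Graph V} where

  fun-injective : (σ : Automorphism H) {x y : V} → fun σ x ≡ fun σ y → x ≡ y
  fun-injective σ {x} {y} eq = begin
    x                  ≡⟨ sym (inv-fun σ x) ⟩
    inv σ (fun σ x)    ≡⟨ cong (inv σ) eq ⟩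
    inv σ (fun σ y)    ≡⟨ inv-fun σ y ⟩
    y                  ∎
    where open ≡-Reasoning

  adj-image : (σ : Automorphism H) {x y x′ y′ : V} →
              fun σ x ≡ x′ → fun σ y ≡ y′ → adj H x′ y′ ≡ adj H x y
  adj-image σ {x} {y} refl refl = preserve σ x y

  inverse : Automorphism H → Automorphism H
  inverse σ = record
    { fun      = inv σ
    ; inv      = fun σ
    ; inv-fun  = fun-inv σ
    ; fun-inv  = inv-fun σ
    ; preserve = λ x y → sym (adj-image σ (fun-inv σ x) (fun-inv σ y))
    }

  inverse-fixes : (σ : Automorphism H) {x : V} → fun σ x ≡ x → inv σ x ≡ x
  inverse-fixes σ {x} fx = trans (cong (inv σ) (sym fx)) (inv-fun σ x)

module ApexFixing {n : ℕ} (G : Graph (Fin n)) where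

  false≢true : false ≢ true
  false≢true ()

  true≢false : true ≢ false
  true≢false ()

  v≢w : ∀ {i : Fin n} → v i ≢ w
  v≢w ()

  -- The shadows are exactly the neighbours of w, so they are permuted.
  shadow↦shadow : (σ : Automorphism (μ G)) → fun σ w ≡ w →
                  ∀ i → Σ (Fin n) λ j → fun σ (u i) ≡ u j
  shadow↦shadow σ fw i with fun σ (u i) in eq
  ... | u j = j , refl
  ... | v j = ⊥-elim (false≢true (adj-image σ fw eq))
  ... | w   = ⊥-elim (false≢true (adj-image σ fw eq))

  -- Originals are non-neighbours of w distinct from w, so they are permuted.
  original↦original : (σ : Automorphism (μ G)) → fun σ w ≡ w →
                      ∀ i → Σ (Fin n) λ j → fun σ (v i) ≡ v j
  original↦original σ fw i with fun σ (v i) in eq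
  ... | v j = j , refl
  ... | u j = ⊥-elim (true≢false (adj-image σ fw eq))
  ... | w   = ⊥-elim (v≢w (fun-injective σ (trans eq (sym fw))))

  v-injective : ∀ {i j : Fin n} → v i ≡ v j → i ≡ j
  v-injective refl = refl

  restrict : (σ : Automorphism (μ G)) → fun σ w ≡ w → Automorphism G
  restrict σ fw = record
    { fun      = π
    ; inv      = π⁻¹
    ; inv-fun  = π⁻¹∘π
    ; fun-inv  = π∘π⁻¹
    ; preserve = λ i j → adj-image σ (π-spec i) (π-spec j)
    }
    where
    open ≡-Reasoning
    π π⁻¹ : Fin n → Fin n
    π   i = proj₁ (original↦original σ fw i)
    π⁻¹ i = proj₁ (original↦original (inverse σ) (inverse-fixes σ fw) i)
    π-spec : ∀ i → fun σ (v i) ≡ v (π i)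
    π-spec i = proj₂ (original↦original σ fw i)
    π⁻¹-spec : ∀ i → inv σ (v i) ≡ v (π⁻¹ i)
    π⁻¹-spec i = proj₂ (original↦original (inverse σ) (inverse-fixes σ fw) i)

    π⁻¹∘π : ∀ i → π⁻¹ (π i) ≡ i
    π⁻¹∘π i = v-injective (begin
      v (π⁻¹ (π i))        ≡⟨ sym (π⁻¹-spec (π i)) ⟩
      inv σ (v (π i))      ≡⟨ cong (inv σ) (sym (π-spec i)) ⟩
      inv σ (fun σ (v i))  ≡⟨ inv-fun σ (v i) ⟩
      v i                  ∎)

    π∘π⁻¹ : ∀ i → π (π⁻¹ i) ≡ i
    π∘π⁻¹ i = v-injective (begin
      v (π (π⁻¹ i))        ≡⟨ sym (π-spec (π⁻¹ i)) ⟩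
      fun σ (v (π⁻¹ i))    ≡⟨ cong (fun σ) (sym (π⁻¹-spec i)) ⟩
      fun σ (inv σ (v i))  ≡⟨ fun-inv σ (v i) ⟩
      v i                  ∎)

  restrict-spec : (σ : Automorphism (μ G)) (fw : fun σ w ≡ w) →
                  ∀ i → fun σ (v i) ≡ v (fun (restrict σ fw) i)
  restrict-spec σ fw i = proj₂ (original↦original σ fw i)

  -- In an R-thin graph, an automorphism of μ(G) fixing w and every
  -- original fixes every shadow: u i and its image u j have the same
  -- neighbours among the originals, i.e. i and j have the same
  -- neighbourhood in G.
  fixes-shadows : RThin G → (σ : Automorphism (μ G)) → fun σ w ≡ w →
                  (∀ i → fun σ (v i) ≡ v i) → ∀ i → fun σ (u i) ≡ u i
  fixes-shadows thin σ fw fv i =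
    trans σui≡uj (cong u (thin j i λ z → adj-image σ σui≡uj (fv z)))
    where
    j : Fin n
    j = proj₁ (shadow↦shadow σ fw i)
    σui≡uj : fun σ (u i) ≡ u j
    σui≡uj = proj₂ (shadow↦shadow σ fw i)

extend : {n d : ℕ} → (Fin n → Fin d) → MV n → Fin (suc d)
extend φ     (v i) = inject₁ (φ i)
extend φ     (u i) = inject₁ (φ i)
extend {d = d} φ w = fromℕ d

fresh-label-only-apex : {n d : ℕ} (φ : Fin n → Fin d) →
                        ∀ x → extend φ x ≡ fromℕ d → x ≡ w
fresh-label-only-apex φ (v i) e = ⊥-elim (fromℕ≢inject₁ (sym e))
fresh-label-only-apex φ (u i) e = ⊥-elim (fromℕ≢inject₁ (sym e))
fresh-label-only-apex φ w     _ = refl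

extend-distinguishing : {n d : ℕ} (G : Graph (Fin n)) → RThin G →
                        (φ : Fin n → Fin d) → Distinguishing G d φ →
                        Distinguishing (μ G) (suc d) (extend φ)
extend-distinguishing G thin φ dist σ lab = fixes
  where
  open ApexFixing G

  fw : fun σ w ≡ w
  fw = fresh-label-only-apex φ (fun σ w) (lab w)

  restriction-fixed : ∀ i → fun (restrict σ fw) i ≡ i
  restriction-fixed = dist (restrict σ fw) λ i →
    inject₁-injective (trans (cong (extend φ) (sym (restrict-spec σ fw i))) (lab (v i)))

  fv : ∀ i → fun σ (v i) ≡ v i
  fv i = trans (restrict-spec σ fw i) (cong v (restriction-fixed i))

  fixes : ∀ x → fun σ x ≡ x
  fixes (v i) = fv i
  fixes (u i) = fixes-shadows thin σ fw fv i
  fixes w     = fw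

mainTheorem12 : (n : ℕ) → 2 ≤ n → (G : Graph (Fin n)) → RThin G →
    (d d′ : ℕ) → IsDistNumber G d → IsDistNumber (μ G) d′ → d′ ≤ d + 1
mainTheorem12 n _ G thin d d′ ((φ , dist) , _) (_ , minimal) =
  minimal (d + 1) (subst (HasDistLabeling (μ G)) (+-comm 1 d)
    (extend φ , extend-distinguishing G thin φ dist))
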